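{- Let $T$ be a (finite) tree with at least four vertices and let $v$ be a leaf of $T$. Then strictly fewer than half of the subtrees of $T$ contain $v$.
   Context: A subtree of $T$ is a nonempty subset $S\subseteq V(T)$ whose induced subgraph $T[S]$ is connected (hence a tree); single vertices are subtrees. A leaf is a vertex of degree at most $1$. -}

module Defs where

open import Data.Nat using (ℕ; suc; _≤_; _+_)
open import Data.Fin using (Fin)
open import Data.Fin.Subset using (Subset; _∈_; Nonempty)
open import Data.List using (List; []; _∷_; length)
open import Data.List.Relation.Unary.Unique.Propositional using (Unique)
open import Data.Product using (_×_; Σ; ∃)
open import Data.Empty using (⊥)
open import Relation.Nullary using (¬_)
open import Relation.Binary.PropositionalEquality using (_≡_)

record Graph (n : ℕ) : Set₁ where
  field
    Adj   : Fin n → Fin n → Set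
    sym   : ∀ {x y} → Adj x y → Adj y x
    irrfl : ∀ {x} → ¬ Adj x x
open Graph public

data WalkIn {n : ℕ} (G : Graph n) (S : Subset n) : Fin n → Fin n → Set where
  here : ∀ {x} → x ∈ S → WalkIn G S x x
  step : ∀ {x y z} → x ∈ S → Adj G x y → WalkIn G S y z → WalkIn G S x z

full : ∀ {n} → Subset n
full = Data.Fin.Subset.⊤

data PathFromTo {n : ℕ} (G : Graph n) : Fin n → List (Fin n) → Fin n → Set where
  single : ∀ {x} → PathFromTo G x (x ∷ []) x
  cons   : ∀ {x y xs z} → Adj G x y → PathFromTo G y xs z → PathFromTo G x (x ∷ xs) z

HasCycle : ∀ {n} → Graph n → Set
HasCycle {n} G = Σ (List (Fin n)) λ xs → Σ (Fin n) λ x → Σ (Fin n) λ z →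
  PathFromTo G x xs z × Adj G z x × Unique xs × (3 ≤ length xs)

Connected : ∀ {n} → Graph n → Set
Connected G = ∀ x y → WalkIn G full x y

IsTree : ∀ {n} → Graph n → Set
IsTree G = Connected G × ¬ HasCycle G

IsLeaf : ∀ {n} → Graph n → Fin n → Set
IsLeaf G v = ∀ {u w} → Adj G v u → Adj G v w → u ≡ w

IsSubtree : ∀ {n} → Graph n → Subset n → Set
IsSubtree G S = Nonempty S × (∀ {x y} → x ∈ S → y ∈ S → WalkIn G S x y)

-- Let u be the neighbour of the leaf v. If a subtree S ∋ v is not {v}, it contains u
-- (a walk inside S from v to any other vertex of S starts with the edge vu), and S − v is
-- again a subtree, because a walk between two vertices ≠ v never needs to enter the
-- leaf v. Fix vertices a, b with u, v, a, b distinct. Then S ↦ S − v, {v} ↦ {a}, is an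
-- injection from the subtrees containing v into the subtrees avoiding v (the images
-- S − v contain u, {a} does not), and {b} is not in its image. So the subtrees avoiding
-- v strictly outnumber those containing v.
module Submission where

open import Defs hiding (sym)
open import Data.Nat using (ℕ; _≤_; _<_; _*_; _+_; suc; z≤n; s≤s)
open import Data.Nat.Properties using (≤-trans; <-irrefl; +-suc; +-identityʳ; +-monoʳ-<; module ≤-Reasoning)
open import Data.Fin as Fin using (Fin)
open import Data.Fin.Properties using (any?)
open import Data.Fin.Subset using (Subset; ⁅_⁆; _─_; _-_; outside; Nonempty)
  renaming (_∈_ to _∈ₛ_; _∉_ to _∉ₛ_)
open import Data.Fin.Subset.Properties
  using (_∈?_; x∈⁅x⁆; x∈⁅y⁆⇒x≡y; x∉⁅y⁆⇒x≢y; x∈p∧x≢y⇒x∈p-y; p─q⊆p; ⊆-antisym)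
open import Data.Vec using (_∷_; here; there)
open import Data.Vec.Properties using (≡-dec)
open import Data.Bool.Properties using () renaming (_≟_ to _≟ᵇ_)
open import Data.List using (List; []; _∷_; length; filter; map; allFin)
open import Data.List.Properties using (filter-notAll; length-map; length-tabulate)
open import Data.List.Membership.Propositional using (_∈_; _∉_; find)
open import Data.List.Membership.Propositional.Properties using (∈-filter⁺; ∈-filter⁻; ∈-map⁻)
open import Data.List.Membership.DecPropositional using () renaming (_∈?_ to ∈?-by)
open import Data.List.Relation.Binary.Subset.Propositional using (_⊆_)
open import Data.List.Relation.Unary.All as All using (all?)
open import Data.List.Relation.Unary.All.Properties using (¬All⇒Any¬) renaming (map⁺ to All-map⁺)
open import Data.List.Relation.Unary.Any as Any using (here; there)
open import Data.List.Relation.Unary.Unique.Propositional using (Unique; []; _∷_)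
open import Data.List.Relation.Unary.Unique.Propositional.Properties using (filter⁺; allFin⁺)
open import Data.Product using (_×_; _,_; ∃; uncurry)
open import Data.Sum using (_⊎_; inj₁; inj₂)
open import Data.Empty using (⊥-elim)
open import Function using (_∘_)
open import Function.Bundles using (_⇔_; Equivalence)
open import Relation.Binary.Definitions using (DecidableEquality)
open import Relation.Binary.PropositionalEquality using (_≡_; _≢_; refl; sym; trans; cong; subst)
open import Relation.Nullary using (yes; no; ¬?)
open import Relation.Nullary.Decidable using (_×-dec_)
open import Relation.Unary using (Decidable)
open import Relation.Unary.Properties using (∁?)

module _ {A : Set} (_≟_ : DecidableEquality A) where

  length-mono-⊆ : ∀ {xs ys : List A} → Unique xs → xs ⊆ ys → length xs ≤ length ys
  length-mono-⊆ {[]} _ _ = z≤n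
  length-mono-⊆ {x ∷ xs} {ys} (x∉xs ∷ xs!) xs⊆ys =
    ≤-trans (s≤s (length-mono-⊆ xs! xs⊆others))
            (filter-notAll x≢? ys (Any.map (λ eq ne → ne eq) (xs⊆ys (here refl))))
    where
    x≢? : Decidable (x ≢_)
    x≢? y = ¬? (x ≟ y)
    xs⊆others : xs ⊆ filter x≢? ys
    xs⊆others y∈xs = ∈-filter⁺ x≢? (xs⊆ys (there y∈xs)) (All.lookup x∉xs y∈xs)

map⁺-injectiveOn : ∀ {A B : Set} (f : A → B) {xs : List A} →
                   (∀ {x y} → x ∈ xs → y ∈ xs → f x ≡ f y → x ≡ y) → Unique xs → Unique (map f xs)
map⁺-injectiveOn f {[]} _ [] = []
map⁺-injectiveOn f {x ∷ xs} inj (x∉xs ∷ xs!) =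
  All-map⁺ (All.tabulate (λ y∈xs fx≡fy → All.lookup x∉xs y∈xs (inj (here refl) (there y∈xs) fx≡fy)))
  ∷ map⁺-injectiveOn f (λ x∈ y∈ → inj (there x∈) (there y∈)) xs!

length-<-injectiveOn : ∀ {A B : Set} → DecidableEquality B →
                       (f : A → B) {xs : List A} {ys : List B} {y : B} →
                       Unique xs → (∀ {x x′} → x ∈ xs → x′ ∈ xs → f x ≡ f x′ → x ≡ x′) →
                       (∀ {x} → x ∈ xs → f x ∈ ys) → y ∈ ys → (∀ {x} → x ∈ xs → y ≢ f x) →
                       length xs < length ys
length-<-injectiveOn _≟_ f {xs} {ys} {y} xs! inj f∈ y∈ys y∉f =
  subst (λ k → suc k ≤ length ys) (length-map f xs) (length-mono-⊆ _≟_ y∷fxs! y∷fxs⊆ys)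
  where
  y∷fxs! : Unique (y ∷ map f xs)
  y∷fxs! = All-map⁺ (All.tabulate y∉f) ∷ map⁺-injectiveOn f inj xs!
  y∷fxs⊆ys : (y ∷ map f xs) ⊆ ys
  y∷fxs⊆ys (here refl) = y∈ys
  y∷fxs⊆ys (there fx∈) with ∈-map⁻ f fx∈
  ... | x , x∈xs , refl = f∈ x∈xs

length-filter-∁ : ∀ {A : Set} {P : A → Set} (P? : Decidable P) (xs : List A) →
                  length xs ≡ length (filter P? xs) + length (filter (∁? P?) xs)
length-filter-∁ P? [] = refl
length-filter-∁ P? (x ∷ xs) with P? x
... | yes _ = cong suc (length-filter-∁ P? xs)
... | no _ = trans (cong suc (length-filter-∁ P? xs)) (sym (+-suc _ _))

fresh : ∀ {n} (ys : List (Fin n)) → length ys < n → ∃ λ x → x ∉ ys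
fresh {n} ys ys<n with all? (λ x → ∈?-by Fin._≟_ x ys) (allFin n)
... | yes allFin⊆ys = ⊥-elim (<-irrefl refl (≤-trans ys<n n≤ys))
  where
  n≤ys : n ≤ length ys
  n≤ys = subst (_≤ length ys) (length-tabulate (λ i → i))
               (length-mono-⊆ Fin._≟_ (allFin⁺ n) (All.lookup allFin⊆ys))
... | no ¬allFin⊆ys =
  let (x , _ , x∉ys) = find (¬All⇒Any¬ (λ x → ∈?-by Fin._≟_ x ys) (allFin n) ¬allFin⊆ys) in x , x∉ys

_≟ₛ_ : ∀ {n} → DecidableEquality (Subset n)
_≟ₛ_ = ≡-dec _≟ᵇ_

x∈p─q⇒x∉q : ∀ {n} (p q : Subset n) {x} → x ∈ₛ p ─ q → x ∉ₛ q
x∈p─q⇒x∉q (_ ∷ p) (outside ∷ q) here ()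
x∈p─q⇒x∉q (_ ∷ p) (_ ∷ q) (there x∈) (there x∈q) = x∈p─q⇒x∉q p q x∈ x∈q

x∈p-y⇒x≢y : ∀ {n} {p : Subset n} {x y} → x ∈ₛ p - y → x ≢ y
x∈p-y⇒x≢y {p = p} {y = y} x∈ = x∉⁅y⁆⇒x≢y (x∈p─q⇒x∉q p ⁅ y ⁆ x∈)

p-x≡q-x⇒p⊆q : ∀ {n} {p q : Subset n} {x} → x ∈ₛ q → p - x ≡ q - x → ∀ {y} → y ∈ₛ p → y ∈ₛ q
p-x≡q-x⇒p⊆q {p = p} {q} {x} x∈q p-x≡q-x {y} y∈p with y Fin.≟ x
... | yes refl = x∈q
... | no y≢x = p─q⊆p q ⁅ x ⁆ (subst (y ∈ₛ_) p-x≡q-x (x∈p∧x≢y⇒x∈p-y y∈p y≢x))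

p-x≡q-x⇒p≡q : ∀ {n} {p q : Subset n} {x} → x ∈ₛ p → x ∈ₛ q → p - x ≡ q - x → p ≡ q
p-x≡q-x⇒p≡q x∈p x∈q eq = ⊆-antisym (p-x≡q-x⇒p⊆q x∈q eq) (p-x≡q-x⇒p⊆q x∈p (sym eq))

p≢⁅x⁆⇒∃≢x : ∀ {n} {p : Subset n} {x} → x ∈ₛ p → p ≢ ⁅ x ⁆ → ∃ λ y → y ∈ₛ p × y ≢ x
p≢⁅x⁆⇒∃≢x {p = p} {x} x∈p p≢⁅x⁆ with any? (λ y → (y ∈? p) ×-dec ¬? (y Fin.≟ x))
... | yes witness = witness
... | no none = ⊥-elim (p≢⁅x⁆ (⊆-antisym p⊆⁅x⁆ (λ y∈ → subst (_∈ₛ p) (sym (x∈⁅y⁆⇒x≡y x y∈)) x∈p)))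
  where
  p⊆⁅x⁆ : ∀ {y} → y ∈ₛ p → y ∈ₛ ⁅ x ⁆
  p⊆⁅x⁆ {y} y∈p with y Fin.≟ x
  ... | yes refl = x∈⁅x⁆ x
  ... | no y≢x = ⊥-elim (none (y , y∈p , y≢x))

walk-head : ∀ {n} {G : Graph n} {S x y} → WalkIn G S x y → x ∈ₛ S
walk-head (here x∈S) = x∈S
walk-head (step x∈S _ _) = x∈S

∃-neighbour : ∀ {n} {G : Graph n} → Connected G → ∀ {x y} → x ≢ y → ∃ (Adj G x)
∃-neighbour connected {x} {y} x≢y with connected x y
... | here _ = ⊥-elim (x≢y refl)
... | step _ x~z _ = _ , x~z

singleton-IsSubtree : ∀ {n} (G : Graph n) (x : Fin n) → IsSubtree G ⁅ x ⁆
singleton-IsSubtree G x = (x , x∈⁅x⁆ x) , λ {y} {z} y∈ z∈ →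
  subst (WalkIn G ⁅ x ⁆ y) (trans (x∈⁅y⁆⇒x≡y x y∈) (sym (x∈⁅y⁆⇒x≡y x z∈))) (here y∈)

module _ {n} {G : Graph n} {v : Fin n} (leaf : IsLeaf G v) where

  leaf-neighbour-∈ : ∀ {S u x} → Adj G v u → WalkIn G S v x → x ≢ v → u ∈ₛ S
  leaf-neighbour-∈ _ (here _) x≢v = ⊥-elim (x≢v refl)
  leaf-neighbour-∈ {S} v~u (step _ v~y y⇝x) _ = subst (_∈ₛ S) (leaf v~y v~u) (walk-head y⇝x)

  -- A walk can enter the leaf v only from its neighbour and must leave back to it.
  walk-avoiding-leaf : ∀ {S x y} → WalkIn G S x y → x ≢ v → y ≢ v → WalkIn G (S - v) x y
  walk-back-from-leaf : ∀ {S x y} → Adj G x v → WalkIn G S v y → x ≢ v → y ≢ v → WalkIn G (S - v) x y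
  walk-avoiding-leaf (here x∈S) x≢v _ = here (x∈p∧x≢y⇒x∈p-y x∈S x≢v)
  walk-avoiding-leaf (step {y = z} x∈S x~z z⇝y) x≢v y≢v with z Fin.≟ v
  ... | no z≢v = step (x∈p∧x≢y⇒x∈p-y x∈S x≢v) x~z (walk-avoiding-leaf z⇝y z≢v y≢v)
  ... | yes refl = walk-back-from-leaf x~z z⇝y x≢v y≢v
  walk-back-from-leaf _ (here _) _ y≢v = ⊥-elim (y≢v refl)
  walk-back-from-leaf x~v (step _ v~w w⇝y) x≢v y≢v with leaf v~w (Graph.sym G x~v)
  ... | refl = walk-avoiding-leaf w⇝y x≢v y≢v

  remove-leaf-IsSubtree : ∀ {S} → IsSubtree G S → Nonempty (S - v) → IsSubtree G (S - v)
  remove-leaf-IsSubtree {S} (_ , connected) nonempty = nonempty , λ x∈ y∈ →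
    walk-avoiding-leaf (connected (p─q⊆p S ⁅ v ⁆ x∈) (p─q⊆p S ⁅ v ⁆ y∈)) (x∈p-y⇒x≢y x∈) (x∈p-y⇒x≢y y∈)

  module Prune {u a : Fin n} (v~u : Adj G v u) (a≢v : a ≢ v) (a≢u : a ≢ u) where

    prune : Subset n → Subset n
    prune S with S ≟ₛ ⁅ v ⁆
    ... | yes _ = ⁅ a ⁆
    ... | no _ = S - v

    u≢v : u ≢ v
    u≢v refl = Graph.irrfl G v~u

    neighbour-∈-remove-leaf : ∀ {S} → IsSubtree G S → v ∈ₛ S → S ≢ ⁅ v ⁆ → u ∈ₛ S - v
    neighbour-∈-remove-leaf (_ , connected) v∈S S≢⁅v⁆ with p≢⁅x⁆⇒∃≢x v∈S S≢⁅v⁆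
    ... | x , x∈S , x≢v = x∈p∧x≢y⇒x∈p-y (leaf-neighbour-∈ v~u (connected v∈S x∈S) x≢v) u≢v

    prune-IsSubtree : ∀ {S} → IsSubtree G S → v ∈ₛ S → IsSubtree G (prune S)
    prune-IsSubtree {S} S-tree v∈S with S ≟ₛ ⁅ v ⁆
    ... | yes _ = singleton-IsSubtree G a
    ... | no S≢⁅v⁆ = remove-leaf-IsSubtree S-tree (u , neighbour-∈-remove-leaf S-tree v∈S S≢⁅v⁆)

    v∉prune : ∀ S → v ∉ₛ prune S
    v∉prune S with S ≟ₛ ⁅ v ⁆
    ... | yes _ = a≢v ∘ sym ∘ x∈⁅y⁆⇒x≡y a
    ... | no _ = λ v∈ → x∈p-y⇒x≢y v∈ refl

    prune≡⁅a⁆⊎u∈prune : ∀ {S} → IsSubtree G S → v ∈ₛ S → prune S ≡ ⁅ a ⁆ ⊎ u ∈ₛ prune S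
    prune≡⁅a⁆⊎u∈prune {S} S-tree v∈S with S ≟ₛ ⁅ v ⁆
    ... | yes _ = inj₁ refl
    ... | no S≢⁅v⁆ = inj₂ (neighbour-∈-remove-leaf S-tree v∈S S≢⁅v⁆)

    u∉⁅a⁆ : u ∉ₛ ⁅ a ⁆
    u∉⁅a⁆ = a≢u ∘ sym ∘ x∈⁅y⁆⇒x≡y a

    prune-injective : ∀ {S S′} → IsSubtree G S → v ∈ₛ S → IsSubtree G S′ → v ∈ₛ S′ →
                      prune S ≡ prune S′ → S ≡ S′
    prune-injective {S} {S′} S-tree v∈S S′-tree v∈S′ eq with S ≟ₛ ⁅ v ⁆ | S′ ≟ₛ ⁅ v ⁆
    ... | yes S≡⁅v⁆ | yes S′≡⁅v⁆ = trans S≡⁅v⁆ (sym S′≡⁅v⁆)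
    ... | yes _ | no S′≢⁅v⁆ = ⊥-elim (u∉⁅a⁆ (subst (u ∈ₛ_) (sym eq) (neighbour-∈-remove-leaf S′-tree v∈S′ S′≢⁅v⁆)))
    ... | no S≢⁅v⁆ | yes _ = ⊥-elim (u∉⁅a⁆ (subst (u ∈ₛ_) eq (neighbour-∈-remove-leaf S-tree v∈S S≢⁅v⁆)))
    ... | no _ | no _ = p-x≡q-x⇒p≡q v∈S v∈S′ eq

    module Enumeration (L : List (Subset n)) (L! : Unique L)
                       (L-subtrees : ∀ S → (S ∈ L) ⇔ IsSubtree G S) where

      through-v avoiding-v : List (Subset n)
      through-v = filter (v ∈?_) L
      avoiding-v = filter (∁? (v ∈?_)) L

      ∈through-v⇒IsSubtree : ∀ {S} → S ∈ through-v → IsSubtree G S × v ∈ₛ S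
      ∈through-v⇒IsSubtree S∈ =
        let (S∈L , v∈S) = ∈-filter⁻ (v ∈?_) S∈ in Equivalence.to (L-subtrees _) S∈L , v∈S

      IsSubtree⇒∈avoiding-v : ∀ {S} → IsSubtree G S → v ∉ₛ S → S ∈ avoiding-v
      IsSubtree⇒∈avoiding-v S-tree v∉S =
        ∈-filter⁺ (∁? (v ∈?_)) (Equivalence.from (L-subtrees _) S-tree) v∉S

      length-through-v<length-avoiding-v : ∀ {b} → b ≢ v → b ≢ u → b ≢ a →
                                           length through-v < length avoiding-v
      length-through-v<length-avoiding-v {b} b≢v b≢u b≢a =
        length-<-injectiveOn _≟ₛ_ prune (filter⁺ (v ∈?_) L!) injective prune∈ ⁅b⁆∈ ⁅b⁆∉image
        where
        injective : ∀ {S S′} → S ∈ through-v → S′ ∈ through-v → prune S ≡ prune S′ → S ≡ S′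
        injective S∈ S′∈ =
          let (S-tree , v∈S) = ∈through-v⇒IsSubtree S∈ ; (S′-tree , v∈S′) = ∈through-v⇒IsSubtree S′∈
          in prune-injective S-tree v∈S S′-tree v∈S′
        prune∈ : ∀ {S} → S ∈ through-v → prune S ∈ avoiding-v
        prune∈ {S} S∈ = let (S-tree , v∈S) = ∈through-v⇒IsSubtree S∈
                        in IsSubtree⇒∈avoiding-v (prune-IsSubtree S-tree v∈S) (v∉prune S)
        ⁅b⁆∈ : ⁅ b ⁆ ∈ avoiding-v
        ⁅b⁆∈ = IsSubtree⇒∈avoiding-v (singleton-IsSubtree G b) (b≢v ∘ sym ∘ x∈⁅y⁆⇒x≡y b)
        ⁅b⁆∉image : ∀ {S} → S ∈ through-v → ⁅ b ⁆ ≢ prune S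
        ⁅b⁆∉image S∈ eq with uncurry prune≡⁅a⁆⊎u∈prune (∈through-v⇒IsSubtree S∈)
        ... | inj₁ ≡⁅a⁆ = b≢a (x∈⁅y⁆⇒x≡y a (subst (b ∈ₛ_) (trans eq ≡⁅a⁆) (x∈⁅x⁆ b)))
        ... | inj₂ u∈ = b≢u (sym (x∈⁅y⁆⇒x≡y b (subst (u ∈ₛ_) (sym eq) u∈)))

lemma1 : (n : ℕ) → 4 ≤ n → (T : Graph n) → IsTree T →
         (v : Fin n) → IsLeaf T v →
         (L : List (Subset n)) → Unique L →
         (∀ S → (S ∈ L) ⇔ IsSubtree T S) →
         2 * length (filter (v ∈?_) L) < length L
lemma1 n 4≤n T (connected , _) v leaf L L! L-subtrees
  with w , w∉[v] ← fresh (v ∷ []) (≤-trans (s≤s (s≤s z≤n)) 4≤n)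
  with u , v~u ← ∃-neighbour connected (w∉[v] ∘ Any.here ∘ sym)
  with a , a∉[u,v] ← fresh (u ∷ v ∷ []) (≤-trans (s≤s (s≤s (s≤s z≤n))) 4≤n)
  with b , b∉[a,u,v] ← fresh (a ∷ u ∷ v ∷ []) 4≤n
  = begin-strict
  2 * length through-v                    ≡⟨ cong (length through-v +_) (+-identityʳ (length through-v)) ⟩
  length through-v + length through-v     <⟨ +-monoʳ-< (length through-v) through-v<avoiding-v ⟩
  length through-v + length avoiding-v    ≡⟨ length-filter-∁ (v ∈?_) L ⟨
  length L                                ∎
  where
  open ≤-Reasoning
  open Prune {G = T} leaf v~u (a∉[u,v] ∘ Any.there ∘ Any.here) (a∉[u,v] ∘ Any.here)
  open Enumeration L L! L-subtrees
  through-v<avoiding-v : length through-v < length avoiding-v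
  through-v<avoiding-v = length-through-v<length-avoiding-v
    (b∉[a,u,v] ∘ Any.there ∘ Any.there ∘ Any.here) (b∉[a,u,v] ∘ Any.there ∘ Any.here) (b∉[a,u,v] ∘ Any.here)
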